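{- Let $\mathcal C,\mathcal F$ be graph classes, and let $\mathsf T$ be an immersive transduction encoding a class $\mathcal D$ with $\mathcal D\supseteq\{G\oplus K_1: G\in\mathcal C\}$ in $\mathcal F$. Then there exists an integer $r$ such that $\mathcal C\sqsubseteq^\circ_{\mathrm{FO}}\mathrm{loc}_r(\mathcal F)$.
   Context: All graphs are finite, simple, undirected. $G\oplus K_1$ is $G$ with an added vertex adjacent to all vertices of $G$. A $\Sigma$-expansion of $G$ ($\Sigma$ a finite set of unary symbols) is $G$ with a subset of $V(G)$ for each symbol. A simple interpretation $(\nu(x),\eta(x,y))$ of first-order formulas over $\{E\}\cup\Sigma$ ($\eta$ symmetric, antireflexive) produces from $G^+$ the graph on $\nu(G^+)$ with edges $uv$ where $G^+\models\eta(u,v)$. A non-copying transduction is a pair $(\Sigma,\mathsf I)$, producing from $G$ all $\mathsf I(G^+)$; it encodes $\mathcal D$ in $\mathcal F$ if each graph of $\mathcal D$ is produced from some graph of $\mathcal F$. $\mathcal C\sqsubseteq^\circ_{\mathrm{FO}}\mathcal D$ means some non-copying transduction encodes $\mathcal C$ in $\mathcal D$. $B_r^G(U)$ is the substructure induced on vertices at distance at most $r$ from $U$. A formula $\phi(x_1,\dots,x_k)$ is $r$-local if $G\models\phi(\bar v)\iff B_r^G(\{v_1,\dots,v_k\})\models\phi(\bar v)$ for every expanded graph $G$ and tuple $\bar v$; strongly $r$-local if moreover it implies $\mathrm{dist}(x_i,x_j)\le r$ for all $i<j$. A transduction is immersive if it is non-copying and its interpretation is strongly $r$-local for some $r$. $\mathrm{loc}_r(\mathcal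 F)=\{B_r^G(v):G\in\mathcal F,v\in V(G)\}$ with $B_r^G(v)$ the subgraph induced by vertices at distance at most $r$ from $v$. -}

module Defs where

open import Data.Nat using (ℕ; zero; suc; _<_)
open import Data.Fin using (Fin; zero; suc) renaming (_<_ to _<ᶠ_)
open import Data.Bool using (Bool; true; false)
open import Data.Product using (Σ; ∃; ∃-syntax; _×_; _,_)
open import Relation.Binary.PropositionalEquality using (_≡_; refl)
open import Relation.Nullary using (¬_)
open import Function.Bundles using (_⇔_)
open import Function.Definitions using (Injective)

record Graph : Set where
  field
    n     : ℕ
    adj   : Fin n → Fin n → Bool
    adj-sym : ∀ u v → adj u v ≡ adj v u
    adj-irr : ∀ v → adj v v ≡ false
open Graph public

GraphClass : Set₁
GraphClass = Graph → Set

⊕K₁-adj : (G : Graph) → Fin (suc (n G)) → Fin (suc (n G)) → Bool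
⊕K₁-adj G zero    zero    = false
⊕K₁-adj G zero    (suc v) = true
⊕K₁-adj G (suc u) zero    = true
⊕K₁-adj G (suc u) (suc v) = adj G u v

⊕K₁-sym : (G : Graph) → ∀ u v → ⊕K₁-adj G u v ≡ ⊕K₁-adj G v u
⊕K₁-sym G zero    zero    = refl
⊕K₁-sym G zero    (suc v) = refl
⊕K₁-sym G (suc u) zero    = refl
⊕K₁-sym G (suc u) (suc v) = adj-sym G u v

⊕K₁-irr : (G : Graph) → ∀ v → ⊕K₁-adj G v v ≡ false
⊕K₁-irr G zero    = refl
⊕K₁-irr G (suc v) = adj-irr G v

_⊕K₁ : Graph → Graph
G ⊕K₁ = record
  { n = suc (n G) ; adj = ⊕K₁-adj G ; adj-sym = ⊕K₁-sym G ; adj-irr = ⊕K₁-irr G }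

-- Σ-expansions, with Σ = Fin k (k unary symbols)

record Str (k : ℕ) : Set where
  field
    gr  : Graph
    col : Fin k → Fin (n gr) → Bool
open Str public

V : ∀ {k} → Str k → Set
V S = Fin (n (gr S))

-- First-order formulas over {E} ∪ Σ with m free variables (de Bruijn)
data Formula (k : ℕ) : ℕ → Set where
  eqᶠ   : ∀ {m} → Fin m → Fin m → Formula k m
  edgeᶠ : ∀ {m} → Fin m → Fin m → Formula k m
  colᶠ  : ∀ {m} → Fin k → Fin m → Formula k m
  notᶠ  : ∀ {m} → Formula k m → Formula k m
  andᶠ  : ∀ {m} → Formula k m → Formula k m → Formula k m
  exᶠ   : ∀ {m} → Formula k (suc m) → Formula k m

ext : ∀ {m} {A : Set} → (Fin m → A) → A → Fin (suc m) → A
ext ρ a zero    = a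
ext ρ a (suc i) = ρ i

sat : ∀ {k m} (S : Str k) → Formula k m → (Fin m → V S) → Set
sat S (eqᶠ i j)   ρ = ρ i ≡ ρ j
sat S (edgeᶠ i j) ρ = adj (gr S) (ρ i) (ρ j) ≡ true
sat S (colᶠ c i)  ρ = col S c (ρ i) ≡ true
sat S (notᶠ φ)    ρ = ¬ sat S φ ρ
sat S (andᶠ φ ψ)  ρ = sat S φ ρ × sat S ψ ρ
sat S (exᶠ φ)     ρ = Σ (V S) λ v → sat S φ (ext ρ v)

single : {A : Set} → A → Fin 1 → A
single a _ = a

pair : {A : Set} → A → A → Fin 2 → A
pair a b zero    = a
pair a b (suc _) = b

data DistLe (G : Graph) : ℕ → Fin (n G) → Fin (n G) → Set where
  here : ∀ {r v} → DistLe G r v v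
  step : ∀ {r u w v} → adj G u w ≡ true → DistLe G r w v → DistLe G (suc r) u v

-- f : H → G witnesses that H is (isomorphic to) the subgraph of G
-- induced on the vertex set P
IsInducedG : (G H : Graph) → (Fin (n G) → Set) → (Fin (n H) → Fin (n G)) → Set
IsInducedG G H P f =
  Injective _≡_ _≡_ f
  × (∀ u → P u ⇔ (∃[ a ] f a ≡ u))
  × (∀ a b → adj H a b ≡ adj G (f a) (f b))

IsInduced : ∀ {k} (S B : Str k) → (V S → Set) → (V B → V S) → Set
IsInduced S B P f =
  IsInducedG (gr S) (gr B) P f × (∀ c a → col B c a ≡ col S c (f a))

InBall : ∀ {k m} (S : Str k) → ℕ → (Fin m → V S) → V S → Set
InBall S r v u = ∃[ i ] DistLe (gr S) r (v i) u

Local : ∀ {k m} → ℕ → Formula k m → Set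
Local {k} {m} r φ =
  ∀ (S B : Str k) (f : V B → V S) (w : Fin m → V B) →
  IsInduced S B (InBall S r (λ i → f (w i))) f →
  (sat S φ (λ i → f (w i)) ⇔ sat B φ w)

StronglyLocal : ∀ {k m} → ℕ → Formula k m → Set
StronglyLocal {k} {m} r φ =
  Local r φ ×
  (∀ (S : Str k) (v : Fin m → V S) → sat S φ v →
     ∀ (i j : Fin m) → i <ᶠ j → DistLe (gr S) r (v i) (v j))

-- Non-copying transductions (Σ = Fin k, simple interpretation (ν, η))

record Transduction : Set where
  field
    k     : ℕ
    ν     : Formula k 1
    η     : Formula k 2
    η-sym : ∀ (S : Str k) u v → sat S η (pair u v) → sat S η (pair v u)
    η-irr : ∀ (S : Str k) v → ¬ sat S η (pair v v)
open Transduction public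

-- T produces (a graph isomorphic to) H from G: for some Σ-expansion G⁺
-- of G, I(G⁺) ≅ H, witnessed by f : V(H) → ν(G⁺) bijective.
Produces : Transduction → Graph → Graph → Set
Produces T G H =
  Σ (Fin (k T) → Fin (n G) → Bool) λ c →
  let S : Str (k T)
      S = record { gr = G ; col = c } in
  Σ (Fin (n H) → Fin (n G)) λ f →
    Injective _≡_ _≡_ f
    × (∀ u → sat S (ν T) (single u) ⇔ (∃[ a ] f a ≡ u))
    × (∀ a b → (adj H a b ≡ true) ⇔ sat S (η T) (pair (f a) (f b)))

Encodes : Transduction → GraphClass → GraphClass → Set
Encodes T 𝒟 ℱ = ∀ H → 𝒟 H → ∃[ G ] (ℱ G × Produces T G H)

_⊑°_ : GraphClass → GraphClass → Set
𝒞 ⊑° 𝒟 = ∃[ T ] Encodes T 𝒞 𝒟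

Immersive : Transduction → Set
Immersive T = ∃[ r ] (StronglyLocal r (ν T) × StronglyLocal r (η T))

loc : ℕ → GraphClass → GraphClass
loc r ℱ H = ∃[ G ] (ℱ G × ∃[ v ] ∃[ f ] IsInducedG G H (DistLe G r v) f)

-- The apex of G ⊕ K₁ is η-adjacent to every other vertex, so strong locality of η places
-- the images of all vertices of G within distance r of the image a of the apex. The r-ball
-- around any pair of such vertices lies inside the 2r-ball around a, so by locality η has
-- the same truth value in F and in that 2r-ball. Hence the 2r-ball, with a fresh colour
-- marking the images of the vertices of G as the domain, produces G by η alone.
module Submission where

open import Defs
open import Data.Bool using (Bool; true)
import Data.Bool.Properties as Bool
open import Data.Empty using (⊥-elim)
open import Data.Fin using (Fin; zero; suc; _≟_)
open import Data.Fin.Properties using (any?; suc-injective)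
open import Data.List using (List; _∷_; filter; allFin; length; lookup)
open import Data.List.Membership.Propositional.Properties
  using (∈-filter⁺; ∈-filter⁻; ∈-allFin; ∈-lookup)
import Data.List.Relation.Unary.All as All
open import Data.List.Relation.Unary.AllPairs using (_∷_)
open import Data.List.Relation.Unary.Any using (index)
open import Data.List.Relation.Unary.Any.Properties using (lookup-index)
open import Data.List.Relation.Unary.Unique.Propositional using (Unique)
open import Data.List.Relation.Unary.Unique.Propositional.Properties using (filter⁺; allFin⁺)
open import Data.Nat using (ℕ; zero; suc; _+_; _≤_; z≤n; s≤s)
open import Data.Nat.Properties using (m≤m+n; m≤n+m)
open import Data.Product using (∃-syntax; _×_; _,_; proj₁; proj₂)
open import Function using (_∘_)
open import Function.Bundles using (_⇔_; mk⇔; Equivalence)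
open import Function.Construct.Composition using (_⇔-∘_)
open import Function.Construct.Symmetry using (⇔-sym)
open import Function.Definitions using (Injective)
open import Relation.Binary.PropositionalEquality
  using (_≡_; refl; sym; trans; cong; subst; subst₂)
open import Relation.Nullary using (Dec; yes; no; does)
open import Relation.Nullary.Decidable using (_×-dec_)
open import Relation.Unary using (Decidable)
open Equivalence using (to; from)

does≡true⇔ : ∀ {A : Set} (A? : Dec A) → (does A? ≡ true) ⇔ A
does≡true⇔ (yes a)  = mk⇔ (λ _ → a) (λ _ → refl)
does≡true⇔ (no ¬a) = mk⇔ (λ ()) (⊥-elim ∘ ¬a)

Unique⇒lookup-injective : ∀ {A : Set} {xs : List A} → Unique xs →
  ∀ {i j} → lookup xs i ≡ lookup xs j → i ≡ j
Unique⇒lookup-injective {xs = _ ∷ _} (_ ∷ _)  {zero}  {zero}  _ = refl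
Unique⇒lookup-injective {xs = _ ∷ _} (x∉ ∷ _) {zero}  {suc j} e = ⊥-elim (All.lookup x∉ (∈-lookup j) e)
Unique⇒lookup-injective {xs = _ ∷ _} (x∉ ∷ _) {suc i} {zero}  e = ⊥-elim (All.lookup x∉ (∈-lookup i) (sym e))
Unique⇒lookup-injective {xs = _ ∷ _} (_ ∷ u)  {suc i} {suc j} e = cong suc (Unique⇒lookup-injective u e)

DistLe-mono : ∀ {G r s u v} → r ≤ s → DistLe G r u v → DistLe G s u v
DistLe-mono _       here       = here
DistLe-mono (s≤s p) (step a d) = step a (DistLe-mono p d)

DistLe-trans : ∀ {G r s u v w} → DistLe G r u v → DistLe G s v w → DistLe G (r + s) u w
DistLe-trans {r = r} {s} here e = DistLe-mono (m≤n+m s r) e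
DistLe-trans (step a d) e = step a (DistLe-trans d e)

DistLe? : (G : Graph) (r : ℕ) (u v : Fin (n G)) → Dec (DistLe G r u v)
DistLe? G r u v with u ≟ v
... | yes refl = yes here
DistLe? G zero    u v | no u≢v = no λ { here → u≢v refl }
DistLe? G (suc r) u v | no u≢v
  with any? (λ w → (adj G u w Bool.≟ true) ×-dec DistLe? G r w v)
... | yes (w , a , d) = yes (step a d)
... | no ∄w = no λ { here → u≢v refl ; (step a d) → ∄w (_ , a , d) }

IsInducedG-resp : ∀ {G H P Q f} → (∀ u → P u ⇔ Q u) →
  IsInducedG G H P f → IsInducedG G H Q f
IsInducedG-resp P⇔Q (f-inj , f-range , f-adj) = f-inj , (λ u → f-range u ⇔-∘ ⇔-sym (P⇔Q u)) , f-adj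

IsInducedG-∘ : ∀ {G H B P Q f g} → IsInducedG G H P f → IsInducedG H B Q g →
  IsInducedG G B (λ u → ∃[ x ] (f x ≡ u × Q x)) (f ∘ g)
IsInducedG-∘ {f = f} {g} (f-inj , f-range , f-adj) (g-inj , g-range , g-adj) =
  g-inj ∘ f-inj , range , λ x y → trans (g-adj x y) (f-adj (g x) (g y))
  where
  range : ∀ u → (∃[ x ] (f x ≡ u × _)) ⇔ (∃[ y ] f (g y) ≡ u)
  range u = mk⇔ (λ { (x , refl , qx) → let y , gy≡x = to (g-range x) qx in y , cong f gy≡x })
                (λ { (y , refl) → g y , refl , from (g-range (g y)) (y , refl) })

module Induced (G : Graph) {P : Fin (n G) → Set} (P? : Decidable P) where
  private
    members : List (Fin (n G))
    members = filter P? (allFin (n G))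

  graph : Graph
  graph = record
    { n = length members
    ; adj = λ i j → adj G (lookup members i) (lookup members j)
    ; adj-sym = λ _ _ → adj-sym G _ _
    ; adj-irr = λ _ → adj-irr G _
    }

  ι : Fin (n graph) → Fin (n G)
  ι = lookup members

  ι-induced : IsInducedG G graph P ι
  ι-induced = Unique⇒lookup-injective (filter⁺ P? (allFin⁺ (n G))) , range , λ _ _ → refl
    where
    range : ∀ u → P u ⇔ (∃[ i ] ι i ≡ u)
    range u = mk⇔ (λ pu → let u∈ = ∈-filter⁺ P? (∈-allFin u) pu in index u∈ , sym (lookup-index u∈))
                  (λ { (i , refl) → proj₂ (∈-filter⁻ P? {xs = allFin (n G)} (∈-lookup i)) })

module _ {G H : Graph} {P : Fin (n G) → Set} {f : Fin (n H) → Fin (n G)}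
         (f-induced : IsInducedG G H P f) where
  private
    f-range = proj₁ (proj₂ f-induced)
    f-adj = proj₂ (proj₂ f-induced)

  embed-DistLe : ∀ {s x y} → DistLe H s x y → DistLe G s (f x) (f y)
  embed-DistLe here = here
  embed-DistLe (step {u = x} {w} a d) = step (trans (sym (f-adj x w)) a) (embed-DistLe d)

  lift-DistLe : ∀ {s x q} → (∀ u → DistLe G s (f x) u → P u) →
    DistLe G s (f x) q → ∃[ y ] (f y ≡ q × DistLe H s x y)
  lift-DistLe ball⊆P here = _ , refl , here
  lift-DistLe {x = x} ball⊆P (step {w = w} a d) with to (f-range w) (ball⊆P w (step a here))
  ... | w′ , refl with lift-DistLe (λ u → ball⊆P u ∘ step a) d
  ...   | y , fy≡q , d′ = y , fy≡q , step (trans (f-adj x w′) a) d′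

sat-cong : ∀ {k m} (S : Str k) (φ : Formula k m) {ρ ρ′ : Fin m → V S} →
  (∀ i → ρ i ≡ ρ′ i) → sat S φ ρ → sat S φ ρ′
sat-cong S (eqᶠ i j)   ρ≗ρ′ s = trans (sym (ρ≗ρ′ i)) (trans s (ρ≗ρ′ j))
sat-cong S (edgeᶠ i j) ρ≗ρ′ s = subst₂ (λ a b → adj (gr S) a b ≡ true) (ρ≗ρ′ i) (ρ≗ρ′ j) s
sat-cong S (colᶠ c i)  ρ≗ρ′ s = subst (λ a → col S c a ≡ true) (ρ≗ρ′ i) s
sat-cong S (notᶠ φ)    ρ≗ρ′ ¬s s′ = ¬s (sat-cong S φ (sym ∘ ρ≗ρ′) s′)
sat-cong S (andᶠ φ ψ)  ρ≗ρ′ (s , t) = sat-cong S φ ρ≗ρ′ s , sat-cong S ψ ρ≗ρ′ t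
sat-cong S (exᶠ φ)     ρ≗ρ′ (v , s) = v , sat-cong S φ ext≗ s
  where
  ext≗ : ∀ i → ext _ v i ≡ ext _ v i
  ext≗ zero    = refl
  ext≗ (suc i) = ρ≗ρ′ i

sat-resp : ∀ {k m} (S : Str k) (φ : Formula k m) {ρ ρ′ : Fin m → V S} →
  (∀ i → ρ i ≡ ρ′ i) → sat S φ ρ ⇔ sat S φ ρ′
sat-resp S φ ρ≗ρ′ = mk⇔ (sat-cong S φ ρ≗ρ′) (sat-cong S φ (sym ∘ ρ≗ρ′))

InBall-resp : ∀ {k m r} {S : Str k} {ρ ρ′ : Fin m → V S} →
  (∀ i → ρ i ≡ ρ′ i) → ∀ u → InBall S r ρ u ⇔ InBall S r ρ′ u
InBall-resp {r = r} {S} ρ≗ρ′ u =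
  mk⇔ (λ { (i , d) → i , subst (λ x → DistLe (gr S) r x u) (ρ≗ρ′ i) d })
      (λ { (i , d) → i , subst (λ x → DistLe (gr S) r x u) (sym (ρ≗ρ′ i)) d })

Local-at : ∀ {k m r} {φ : Formula k m} → Local r φ →
  ∀ {S B : Str k} {f : V B → V S} {v w} → IsInduced S B (InBall S r v) f →
  (∀ i → f (w i) ≡ v i) → sat S φ v ⇔ sat B φ w
Local-at {φ = φ} local {S} {B} {f} {w = w} (f-induced , f-col) fw≡v =
  local S B f w (IsInducedG-resp {G = gr S} {gr B} (InBall-resp {S = S} (sym ∘ fw≡v)) f-induced , f-col)
  ⇔-∘ sat-resp S φ (sym ∘ fw≡v)

module _ {k r} {S H : Str k} {P : V S → Set} {h : V H → V S} (h-induced : IsInducedG (gr S) (gr H) P h)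
         {m} (w : Fin m → V H) (ball⊆P : ∀ u → InBall S r (h ∘ w) u → P u) where

  InBall-lift : ∀ u → InBall S r (h ∘ w) u ⇔ (∃[ x ] (h x ≡ u × InBall H r w x))
  InBall-lift u = mk⇔
    (λ { (i , d) → let x , hx≡u , d′ = lift-DistLe h-induced (λ u′ → ball⊆P u′ ∘ (i ,_)) d
                   in x , hx≡u , i , d′ })
    (λ { (x , refl , i , d) → i , embed-DistLe h-induced d })

  -- The r-ball of H around w is also the r-ball of S around h ∘ w, so locality applies twice.
  sat-induced : ∀ {φ : Formula k m} → Local r φ → (∀ c x → col H c x ≡ col S c (h x)) →
    sat S φ (h ∘ w) ⇔ sat H φ w
  sat-induced local h-col = ⇔-sym (Local-at local {H} {B} (b-induced , λ _ _ → refl) b-wB)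
                            ⇔-∘ Local-at local {S} {B} (hb-induced , λ c → h-col c ∘ b) (cong h ∘ b-wB)
    where
    open Induced (gr H) (λ x → any? λ i → DistLe? (gr H) r (w i) x)
      renaming (graph to ball; ι to b; ι-induced to b-induced)
    B : Str k
    B = record { gr = ball ; col = λ c → col H c ∘ b }
    center : ∀ i → ∃[ y ] b y ≡ w i
    center i = to (proj₁ (proj₂ b-induced) (w i)) (i , here)
    b-wB : ∀ i → b (proj₁ (center i)) ≡ w i
    b-wB = proj₂ ∘ center
    hb-induced : IsInducedG (gr S) ball (InBall S r (h ∘ w)) (h ∘ b)
    hb-induced = IsInducedG-resp {G = gr S} {ball} (⇔-sym ∘ InBall-lift)
                   (IsInducedG-∘ {G = gr S} {gr H} {ball} h-induced b-induced)

weaken : ∀ {k m} → Formula k m → Formula (suc k) m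
weaken (eqᶠ i j)   = eqᶠ i j
weaken (edgeᶠ i j) = edgeᶠ i j
weaken (colᶠ c i)  = colᶠ (suc c) i
weaken (notᶠ φ)    = notᶠ (weaken φ)
weaken (andᶠ φ ψ)  = andᶠ (weaken φ) (weaken ψ)
weaken (exᶠ φ)     = exᶠ (weaken φ)

reduct : ∀ {k} → Str (suc k) → Str k
reduct S = record { gr = gr S ; col = col S ∘ suc }

sat-weaken : ∀ {k m} (S : Str (suc k)) (φ : Formula k m) (ρ : Fin m → V S) →
  sat S (weaken φ) ρ ⇔ sat (reduct S) φ ρ
sat-weaken S (eqᶠ i j)   ρ = mk⇔ (λ s → s) (λ s → s)
sat-weaken S (edgeᶠ i j) ρ = mk⇔ (λ s → s) (λ s → s)
sat-weaken S (colᶠ c i)  ρ = mk⇔ (λ s → s) (λ s → s)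
sat-weaken S (notᶠ φ)    ρ = mk⇔ (λ ¬s → ¬s ∘ from (sat-weaken S φ ρ)) (λ ¬s → ¬s ∘ to (sat-weaken S φ ρ))
sat-weaken S (andᶠ φ ψ)  ρ =
  mk⇔ (λ (s , t) → to (sat-weaken S φ ρ) s , to (sat-weaken S ψ ρ) t)
      (λ (s , t) → from (sat-weaken S φ ρ) s , from (sat-weaken S ψ ρ) t)
sat-weaken S (exᶠ φ)     ρ =
  mk⇔ (λ (v , s) → v , to (sat-weaken S φ (ext ρ v)) s)
      (λ (v , s) → v , from (sat-weaken S φ (ext ρ v)) s)

restrictToMarked : Transduction → Transduction
restrictToMarked T = record
  { k = suc (k T)
  ; ν = colᶠ zero zero
  ; η = weaken (η T)
  ; η-sym = λ S u v → from (sat-weaken S (η T) _) ∘ η-sym T (reduct S) u v ∘ to (sat-weaken S (η T) _)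
  ; η-irr = λ S v → η-irr T (reduct S) v ∘ to (sat-weaken S (η T) _)
  }

restrictToMarked-produces :
  (T : Transduction) {r : ℕ} → Local r (η T) →
  {F G : Graph} (c : Fin (k T) → Fin (n F) → Bool) (a : Fin (n F)) {f : Fin (n G) → Fin (n F)} →
  Injective _≡_ _≡_ f →
  (∀ u v → (adj G u v ≡ true) ⇔ sat (record { gr = F ; col = c }) (η T) (pair (f u) (f v))) →
  (∀ v → DistLe F r a (f v)) →
  ∃[ H ] ∃[ h ] (IsInducedG F H (DistLe F (r + r) a) h × Produces (restrictToMarked T) H G)
restrictToMarked-produces T {r} η-local {F} {G} c a {f} f-inj f-η near =
  ball , ι , ι-induced , marking , f′ , f′-inj , marked⇔image , edges
  where
  open Induced F (DistLe? F (r + r) a) renaming (graph to ball)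
  ι-inj = proj₁ ι-induced
  ι-range = proj₁ (proj₂ ι-induced)

  preimage : ∀ v → ∃[ x ] ι x ≡ f v
  preimage v = to (ι-range (f v)) (DistLe-mono (m≤m+n r r) (near v))
  f′ : Fin (n G) → Fin (n ball)
  f′ = proj₁ ∘ preimage
  ι-f′ : ∀ v → ι (f′ v) ≡ f v
  ι-f′ = proj₂ ∘ preimage

  f′-inj : Injective _≡_ _≡_ f′
  f′-inj {u} {v} e = f-inj (trans (sym (ι-f′ u)) (trans (cong ι e) (ι-f′ v)))

  marking : Fin (suc (k T)) → Fin (n ball) → Bool
  marking zero    x = does (any? λ v → f v ≟ ι x)
  marking (suc j) x = c j (ι x)

  marked⇔image : ∀ x → (marking zero x ≡ true) ⇔ (∃[ v ] f′ v ≡ x)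
  marked⇔image x = mk⇔ (λ (v , fv≡ιx) → v , ι-inj (trans (ι-f′ v) fv≡ιx))
                       (λ { (v , refl) → v , sym (ι-f′ v) })
                   ⇔-∘ does≡true⇔ (any? λ v → f v ≟ ι x)

  edges : ∀ u v → (adj G u v ≡ true) ⇔ sat (record { gr = ball ; col = marking }) (weaken (η T)) (pair (f′ u) (f′ v))
  edges u v = ⇔-sym (sat-weaken _ (η T) _)
              ⇔-∘ (sat-induced ι-induced (pair (f′ u) (f′ v)) ball⊆ η-local (λ _ _ → refl)
              ⇔-∘ (sat-resp _ (η T) ι-pair
              ⇔-∘ f-η u v))
    where
    ι-pair : ∀ i → pair (f u) (f v) i ≡ ι (pair (f′ u) (f′ v) i)
    ι-pair zero    = sym (ι-f′ u)
    ι-pair (suc _) = sym (ι-f′ v)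
    ball⊆ : ∀ x → InBall (record { gr = F ; col = c }) r (ι ∘ pair (f′ u) (f′ v)) x → DistLe F (r + r) a x
    ball⊆ x (i , d) = DistLe-trans (subst (DistLe F r a) (ι-pair i) (near′ i)) d
      where
      near′ : ∀ i → DistLe F r a (pair (f u) (f v) i)
      near′ zero    = near u
      near′ (suc _) = near v

lemma3p3 : (𝒞 ℱ 𝒟 : GraphClass) (T : Transduction) →
    Immersive T →
    (∀ G → 𝒞 G → 𝒟 (G ⊕K₁)) →
    Encodes T 𝒟 ℱ →
    ∃[ r ] (𝒞 ⊑° loc r ℱ)
lemma3p3 𝒞 ℱ 𝒟 T (r , _ , η-local , η-near) 𝒞⊕K₁⊆𝒟 T-encodes = r + r , restrictToMarked T , encodes
  where
  encodes : Encodes (restrictToMarked T) 𝒞 (loc (r + r) ℱ)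
  encodes G G∈𝒞 with T-encodes (G ⊕K₁) (𝒞⊕K₁⊆𝒟 G G∈𝒞)
  ... | F , F∈ℱ , c , g , g-inj , _ , g-η
    with restrictToMarked-produces T η-local {F} {G} c (g zero) (λ e → suc-injective (g-inj e))
           (λ u v → g-η (suc u) (suc v)) apex-near
    where
    apex-near : ∀ v → DistLe F r (g zero) (g (suc v))
    apex-near v = η-near _ (pair (g zero) (g (suc v))) (to (g-η zero (suc v)) refl) zero (suc zero) (s≤s z≤n)
  ... | H , h , h-induced , H-produces-G = H , (F , F∈ℱ , g zero , h , h-induced) , H-produces-G
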